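{- For every $n\ge0$, $\det[S(i,j)]_{0\le i,j\le n}=\det[C(i,j)]_{0\le i,j\le n}=2^{n(n+1)/2}$.
   Context: For $i,j\ge0$, $S(i,j)$ is the number of $(x_1,\dots,x_j)\in\mathbb{Z}^j$ with $|x_1|+\cdots+|x_j|=i$ (with $S(0,0)=1$ and $S(i,0)=0$ for $i\ge1$), and $C(i,j)=S(i,j+1)$. -}

module Defs where

open import Data.Nat as ℕ using (ℕ; zero; suc)
open import Data.Integer as ℤ using (ℤ; +_; -_; _*_; _+_; ∣_∣)
open import Data.Fin using (Fin; zero; suc; toℕ; punchIn)
open import Data.List using (List; []; _∷_; map; concatMap; filter; length; upTo)
open import Data.Vec using (Vec; []; _∷_; foldr)
open import Relation.Binary.PropositionalEquality using (_≡_)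
open import Data.Nat.Properties using (_≟_)

box1 : ℕ → List ℤ
box1 i = map (λ k → + k) (upTo (suc i)) Data.List.++ map (λ k → - (+ suc k)) (upTo i)

box : (i j : ℕ) → List (Vec ℤ j)
box i zero    = [] ∷ []
box i (suc j) = concatMap (λ x → map (x ∷_) (box i j)) (box1 i)

norm1 : ∀ {j} → Vec ℤ j → ℕ
norm1 = foldr _ (λ x s → ∣ x ∣ ℕ.+ s) 0

-- S(i,j) = #{ x ∈ ℤ^j : |x₁|+...+|x_j| = i }.
-- Every such x lies in the box [-i,i]^j, so it suffices to count there.
S : ℕ → ℕ → ℕ
S i j = length (filter (λ x → norm1 x ≟ i) (box i j))

C : ℕ → ℕ → ℕ
C i j = S i (suc j)

Matrix : ℕ → Set
Matrix n = Fin n → Fin n → ℤ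

sumFin : ∀ {n} → (Fin n → ℤ) → ℤ
sumFin {zero}  f = + 0
sumFin {suc n} f = f zero + sumFin (λ k → f (suc k))

sign : ℕ → ℤ
sign zero          = + 1
sign (suc zero)    = - (+ 1)
sign (suc (suc k)) = sign k

minor : ∀ {n} → Matrix (suc n) → Fin (suc n) → Matrix n
minor M k i j = M (suc i) (punchIn k j)

det : ∀ {n} → Matrix n → ℤ
det {zero}  M = + 1
det {suc n} M = sumFin (λ k → sign (toℕ k) * M zero k * det (minor M k))

{-# OPTIONS --safe #-}
module Submission where

-- Sorting the lattice points by their first coordinate shows that S satisfies the
-- Delannoy-type recurrence S(i+1,j+1) = S(i+1,j) + S(i,j+1) + S(i,j), with S(0,j) = 1,
-- S(i+1,0) = 0 and S(i+1,1) = 2. If an array M obeys this recurrence and its first column is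
-- constantly 2^m, subtracting from every row the previous one clears the first column below
-- the top and leaves the array M(i+1,j) + M(i,j), which obeys the same recurrence with first
-- column 2^(m+1); hence the n×n determinant is 2^m 2^(m+1) ⋯ 2^(m+n-1). Both matrices of the
-- theorem reduce, by such row operations and one expansion along the first column, to the
-- n×n block of S(i+1,j+1), whose first column is constantly 2.

module Determinant where

  open import Defs
  open import Data.Nat using (zero; suc)
  open import Data.Integer using (ℤ; +_; -_; _+_; _*_; _-_; 0ℤ; -1ℤ)
  open import Data.Integer.Properties
    using (+-*-semiring; neg-involutive; neg-distribˡ-*; +-identityʳ; *-identityˡ; *-zeroˡ; *-zeroʳ)
  open import Data.Integer.Tactic.RingSolver using (solve-∀)
  open import Data.Fin using (Fin; zero; suc; toℕ; punchIn; inject₁; lift)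
  open import Data.Vec.Functional using (_∷_)
  open import Algebra.Properties.Semiring.Sum +-*-semiring
    using (sum; sum-cong-≗; ∑-distrib-+; *-distribˡ-sum; sum-replicate-zero)
  open import Function using (_∘_)
  open import Relation.Binary.PropositionalEquality
  open ≡-Reasoning

  sumFin≡sum : ∀ {n} (f : Fin n → ℤ) → sumFin f ≡ sum f
  sumFin≡sum {zero}  f = refl
  sumFin≡sum {suc n} f = cong (λ s → f zero + s) (sumFin≡sum (λ k → f (suc k)))

  sumFin-cong : ∀ {n} {f g : Fin n → ℤ} → (∀ k → f k ≡ g k) → sumFin f ≡ sumFin g
  sumFin-cong {f = f} {g} f≗g = begin
    sumFin f ≡⟨ sumFin≡sum f ⟩
    sum f    ≡⟨ sum-cong-≗ f≗g ⟩
    sum g    ≡⟨ sumFin≡sum g ⟨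
    sumFin g ∎

  sumFin-zero : ∀ {n} {f : Fin n → ℤ} → (∀ k → f k ≡ 0ℤ) → sumFin f ≡ 0ℤ
  sumFin-zero {n} f≗0 =
    trans (sumFin-cong {g = λ (_ : Fin n) → 0ℤ} f≗0) (trans (sumFin≡sum (λ (_ : Fin n) → 0ℤ)) (sum-replicate-zero n))

  sumFin-* : ∀ {n} (c : ℤ) (f : Fin n → ℤ) → sumFin (λ k → c * f k) ≡ c * sumFin f
  sumFin-* c f = begin
    sumFin (λ k → c * f k) ≡⟨ sumFin≡sum (λ k → c * f k) ⟩
    sum (λ k → c * f k)    ≡⟨ *-distribˡ-sum c f ⟨
    c * sum f              ≡⟨ cong (c *_) (sumFin≡sum f) ⟨
    c * sumFin f           ∎

  sumFin-linear : ∀ {n} (c : ℤ) (f g : Fin n → ℤ) →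
                  sumFin (λ k → f k + c * g k) ≡ sumFin f + c * sumFin g
  sumFin-linear c f g = begin
    sumFin (λ k → f k + c * g k)      ≡⟨ sumFin≡sum (λ k → f k + c * g k) ⟩
    sum (λ k → f k + c * g k)         ≡⟨ ∑-distrib-+ f (λ k → c * g k) ⟩
    sum f + sum (λ k → c * g k)       ≡⟨ cong₂ _+_ (sumFin≡sum f) (sumFin≡sum (λ k → c * g k)) ⟨
    sumFin f + sumFin (λ k → c * g k) ≡⟨ cong (λ s → sumFin f + s) (sumFin-* c g) ⟩
    sumFin f + c * sumFin g           ∎

  sign-suc : ∀ n → sign (suc n) ≡ - sign n
  sign-suc zero    = refl
  sign-suc (suc n) = trans (sym (neg-involutive (sign n))) (cong -_ (sym (sign-suc n)))

  det-cong : ∀ {n} {M N : Matrix n} → (∀ i j → M i j ≡ N i j) → det M ≡ det N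
  det-cong {zero}  _   = refl
  det-cong {suc n} M≗N = sumFin-cong λ k →
    cong₂ (λ x d → sign (toℕ k) * x * d) (M≗N zero k) (det-cong λ i j → M≗N (suc i) (punchIn k j))

  laplaceTerm : ∀ {n} → Matrix (suc n) → Fin (suc n) → ℤ
  laplaceTerm M k = sign (toℕ k) * M zero k * det (minor M k)

  det-linear-head : ∀ {n} (c : ℤ) (u v : Fin (suc n) → ℤ) (R : Fin n → Fin (suc n) → ℤ) →
                    det ((λ j → u j + c * v j) ∷ R) ≡ det (u ∷ R) + c * det (v ∷ R)
  det-linear-head c u v R = trans (sumFin-cong λ k → expand c (sign (toℕ k)) (u k) (v k) (det (minor (u ∷ R) k)))
                                  (sumFin-linear c (laplaceTerm (u ∷ R)) (laplaceTerm (v ∷ R)))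
    where
    expand : ∀ c s x y d → s * (x + c * y) * d ≡ s * x * d + c * (s * y * d)
    expand = solve-∀

  det-linear-second : ∀ {n} (c : ℤ) (r u v : Fin (suc (suc n)) → ℤ) (R : Fin n → Fin (suc (suc n)) → ℤ) →
                      det (r ∷ (λ j → u j + c * v j) ∷ R) ≡ det (r ∷ u ∷ R) + c * det (r ∷ v ∷ R)
  det-linear-second c r u v R =
    trans (sumFin-cong expandMinor) (sumFin-linear c (laplaceTerm (r ∷ u ∷ R)) (laplaceTerm (r ∷ v ∷ R)))
    where
    expand : ∀ c s x a b → s * x * (a + c * b) ≡ s * x * a + c * (s * x * b)
    expand = solve-∀
    expandMinor : ∀ k → laplaceTerm (r ∷ (λ j → u j + c * v j) ∷ R) k
                      ≡ laplaceTerm (r ∷ u ∷ R) k + c * laplaceTerm (r ∷ v ∷ R) k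
    expandMinor k =
      trans (cong (sign (toℕ k) * r k *_) (det-linear-head c (u ∘ punchIn k) (v ∘ punchIn k) (λ i j → R i (punchIn k j))))
            (expand c (sign (toℕ k)) (r k) (det (minor (r ∷ u ∷ R) k)) (det (minor (r ∷ v ∷ R) k)))

  -- Stands in for function extensionality on column selections σ.
  RespectsPointwise : ∀ {m p} → ((Fin m → Fin p) → ℤ) → Set
  RespectsPointwise Φ = ∀ {σ τ} → (∀ j → σ j ≡ τ j) → Φ σ ≡ Φ τ

  -- The expansion of det (u ∷ u ∷ R) along both of its first rows: (k , punchIn k l) runs
  -- over the ordered pairs of distinct columns used by the two rows.
  doubleExpansion : ∀ {m} → (Fin (suc (suc m)) → ℤ) → ((Fin m → Fin (suc (suc m))) → ℤ) → ℤ
  doubleExpansion a Φ =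
    sumFin λ k → sign (toℕ k) * a k *
      sumFin λ l → sign (toℕ l) * a (punchIn k l) * Φ (λ j → punchIn k (punchIn l j))

  pairsAvoiding₀ : ∀ {m} → (Fin (suc (suc m)) → ℤ) → ((Fin m → Fin (suc (suc m))) → ℤ) → ℤ
  pairsAvoiding₀ a Φ =
    sumFin λ k → sign (suc (toℕ k)) * a (suc k) *
      sumFin λ l → sign (suc (toℕ l)) * a (suc (punchIn k l)) * Φ (λ j → punchIn (suc k) (punchIn (suc l) j))

  -- A term using column 0 in one of the two rows cancels the term using the same two columns
  -- in the opposite order.
  doubleExpansion≡pairsAvoiding₀ : ∀ {m} (a : Fin (suc (suc m)) → ℤ) (Φ : (Fin m → Fin (suc (suc m))) → ℤ) →
                                   doubleExpansion a Φ ≡ pairsAvoiding₀ a Φ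
  doubleExpansion≡pairsAvoiding₀ {m} a Φ = begin
    doubleExpansion a Φ
      ≡⟨ cong₂ _+_ column₀ (sumFin-cong otherColumn) ⟩
    sumFin cross + sumFin (λ k → rest k + -1ℤ * cross k)
      ≡⟨ cong (λ s → sumFin cross + s) (sumFin-linear -1ℤ rest cross) ⟩
    sumFin cross + (pairsAvoiding₀ a Φ + -1ℤ * sumFin cross)
      ≡⟨ cancel (sumFin cross) (pairsAvoiding₀ a Φ) ⟩
    pairsAvoiding₀ a Φ ∎
    where
    swapped : Fin (suc m) → ℤ
    swapped k = Φ (λ j → suc (punchIn k j))
    cross : Fin (suc m) → ℤ
    cross k = sign (toℕ k) * (a zero * a (suc k) * swapped k)
    inner : Fin (suc m) → ℤ
    inner k = sumFin λ l → sign (suc (toℕ l)) * a (suc (punchIn k l)) * Φ (λ j → punchIn (suc k) (punchIn (suc l) j))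
    rest : Fin (suc m) → ℤ
    rest k = sign (suc (toℕ k)) * a (suc k) * inner k
    column₀ : sign 0 * a zero * sumFin (λ l → sign (toℕ l) * a (suc l) * swapped l) ≡ sumFin cross
    column₀ = begin
      sign 0 * a zero * sumFin (λ l → sign (toℕ l) * a (suc l) * swapped l)
        ≡⟨ cong (_* sumFin (λ l → sign (toℕ l) * a (suc l) * swapped l)) (*-identityˡ (a zero)) ⟩
      a zero * sumFin (λ l → sign (toℕ l) * a (suc l) * swapped l)
        ≡⟨ sumFin-* (a zero) (λ l → sign (toℕ l) * a (suc l) * swapped l) ⟨
      sumFin (λ l → a zero * (sign (toℕ l) * a (suc l) * swapped l))
        ≡⟨ sumFin-cong (λ l → reorder (a zero) (sign (toℕ l)) (a (suc l)) (swapped l)) ⟩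
      sumFin cross ∎
      where
      reorder : ∀ x s y w → x * (s * y * w) ≡ s * (x * y * w)
      reorder = solve-∀
    otherColumn : ∀ k → sign (suc (toℕ k)) * a (suc k) * (sign 0 * a zero * swapped k + inner k)
                      ≡ sign (suc (toℕ k)) * a (suc k) * inner k + -1ℤ * cross k
    otherColumn k rewrite sign-suc (toℕ k) = expand (sign (toℕ k)) (a (suc k)) (a zero) (swapped k) (inner k)
      where
      expand : ∀ s y x w i → - s * y * (+ 1 * x * w + i) ≡ - s * y * i + -1ℤ * (s * (x * y * w))
      expand = solve-∀
    cancel : ∀ x y → x + (y + -1ℤ * x) ≡ y
    cancel = solve-∀

  pairsAvoiding₀-shift : ∀ {m} (a : Fin (suc (suc (suc m))) → ℤ) (Φ : (Fin (suc m) → Fin (suc (suc (suc m)))) → ℤ) →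
                         RespectsPointwise Φ → pairsAvoiding₀ a Φ ≡ doubleExpansion (a ∘ suc) (Φ ∘ lift 1)
  pairsAvoiding₀-shift {m} a Φ Φ-resp = sumFin-cong λ k →
    trans (cong₂ (λ s i → s * a (suc k) * i) (sign-suc (toℕ k)) (trans (sumFin-cong (innerTerm k)) (sumFin-* -1ℤ (term k))))
          (flip² (sign (toℕ k)) (a (suc k)) (sumFin (term k)))
    where
    term : Fin (suc (suc m)) → Fin (suc m) → ℤ
    term k l = sign (toℕ l) * a (suc (punchIn k l)) * Φ (lift 1 (λ j → punchIn k (punchIn l j)))
    flip : ∀ s y p → - s * y * p ≡ -1ℤ * (s * y * p)
    flip = solve-∀
    flip² : ∀ s y i → - s * y * (-1ℤ * i) ≡ s * y * i
    flip² = solve-∀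
    innerTerm : ∀ k l → sign (suc (toℕ l)) * a (suc (punchIn k l)) * Φ (λ j → punchIn (suc k) (punchIn (suc l) j))
                      ≡ -1ℤ * term k l
    innerTerm k l =
      trans (cong₂ (λ s p → s * a (suc (punchIn k l)) * p) (sign-suc (toℕ l)) (Φ-resp λ { zero → refl ; (suc j) → refl }))
            (flip (sign (toℕ l)) (a (suc (punchIn k l))) (Φ (lift 1 (λ j → punchIn k (punchIn l j)))))

  doubleExpansion≡0 : ∀ {m} (a : Fin (suc (suc m)) → ℤ) (Φ : (Fin m → Fin (suc (suc m))) → ℤ) →
                      RespectsPointwise Φ → doubleExpansion a Φ ≡ 0ℤ
  doubleExpansion≡0 {zero} a Φ Φ-resp =
    trans (doubleExpansion≡pairsAvoiding₀ a Φ) (sumFin-zero λ k → *-zeroʳ (sign (suc (toℕ k)) * a (suc k)))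
  doubleExpansion≡0 {suc m} a Φ Φ-resp = begin
    doubleExpansion a Φ                        ≡⟨ doubleExpansion≡pairsAvoiding₀ a Φ ⟩
    pairsAvoiding₀ a Φ                         ≡⟨ pairsAvoiding₀-shift a Φ Φ-resp ⟩
    doubleExpansion (a ∘ suc) (Φ ∘ lift 1)     ≡⟨ doubleExpansion≡0 (a ∘ suc) (Φ ∘ lift 1) lift-resp ⟩
    0ℤ                                         ∎
    where
    lift-resp : RespectsPointwise (Φ ∘ lift 1)
    lift-resp σ≗τ = Φ-resp λ { zero → refl ; (suc j) → cong suc (σ≗τ j) }

  det-repeatedHead≡0 : ∀ {n} (u : Fin (suc (suc n)) → ℤ) (R : Fin n → Fin (suc (suc n)) → ℤ) →
                       det (u ∷ u ∷ R) ≡ 0ℤ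
  det-repeatedHead≡0 u R =
    doubleExpansion≡0 u (λ σ → det (λ i j → R i (σ j))) (λ σ≗τ → det-cong λ i j → cong (R i) (σ≗τ j))

  det-addMultipleOfHead : ∀ {n} (c : ℤ) (r u : Fin (suc (suc n)) → ℤ) (R : Fin n → Fin (suc (suc n)) → ℤ) →
                          det (r ∷ (λ j → u j + c * r j) ∷ R) ≡ det (r ∷ u ∷ R)
  det-addMultipleOfHead c r u R = begin
    det (r ∷ (λ j → u j + c * r j) ∷ R)         ≡⟨ det-linear-second c r u r R ⟩
    det (r ∷ u ∷ R) + c * det (r ∷ r ∷ R)       ≡⟨ cong (λ d → det (r ∷ u ∷ R) + c * d) (det-repeatedHead≡0 r R) ⟩
    det (r ∷ u ∷ R) + c * 0ℤ                    ≡⟨ cong (λ d → det (r ∷ u ∷ R) + d) (*-zeroʳ c) ⟩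
    det (r ∷ u ∷ R) + 0ℤ                        ≡⟨ +-identityʳ _ ⟩
    det (r ∷ u ∷ R)                             ∎

  subtractPrevious : ∀ {n} → (Fin n → ℤ) → Matrix (suc n) → Matrix (suc n)
  subtractPrevious c M zero    j = M zero j
  subtractPrevious c M (suc i) j = M (suc i) j - c i * M (inject₁ i) j

  det-subtractPrevious : ∀ {n} (c : Fin n → ℤ) (M : Matrix (suc n)) → det (subtractPrevious c M) ≡ det M
  det-subtractPrevious {zero}  c M = refl
  det-subtractPrevious {suc n} c M = begin
    det (subtractPrevious c M)
      ≡⟨ det-cong asAddition ⟩
    det (M zero ∷ (λ j → M (suc zero) j + - c zero * M zero j) ∷ lower)
      ≡⟨ det-addMultipleOfHead (- c zero) (M zero) (M (suc zero)) lower ⟩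
    det (M zero ∷ M (suc zero) ∷ lower)
      ≡⟨ sumFin-cong (λ k → cong (sign (toℕ k) * M zero k *_) (det-minor k)) ⟩
    det M ∎
    where
    lower : Fin n → Fin (suc (suc n)) → ℤ
    lower i = subtractPrevious c M (suc (suc i))
    asAddition : ∀ i j → subtractPrevious c M i j ≡ (M zero ∷ (λ j → M (suc zero) j + - c zero * M zero j) ∷ lower) i j
    asAddition zero          j = refl
    asAddition (suc zero)    j = cong (λ x → M (suc zero) j + x) (neg-distribˡ-* (c zero) (M zero j))
    asAddition (suc (suc i)) j = refl
    minor≗ : ∀ k i j → minor (M zero ∷ M (suc zero) ∷ lower) k i j ≡ subtractPrevious (c ∘ suc) (minor M k) i j
    minor≗ k zero    j = refl
    minor≗ k (suc i) j = refl
    det-minor : ∀ k → det (minor (M zero ∷ M (suc zero) ∷ lower) k) ≡ det (minor M k)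
    det-minor k = trans (det-cong (minor≗ k)) (det-subtractPrevious (c ∘ suc) (minor M k))

  det-zeroColumn₀ : ∀ {n} (M : Matrix (suc n)) → (∀ i → M i zero ≡ 0ℤ) → det M ≡ 0ℤ
  det-pivotColumn₀ : ∀ {n} (M : Matrix (suc n)) → (∀ i → M (suc i) zero ≡ 0ℤ) →
                     det M ≡ M zero zero * det (minor M zero)

  det-zeroColumn₀ M column₀≡0 = begin
    det M                             ≡⟨ det-pivotColumn₀ M (column₀≡0 ∘ suc) ⟩
    M zero zero * det (minor M zero)  ≡⟨ cong (_* det (minor M zero)) (column₀≡0 zero) ⟩
    0ℤ * det (minor M zero)           ≡⟨ *-zeroˡ (det (minor M zero)) ⟩
    0ℤ                                ∎

  det-pivotColumn₀ {n} M below≡0 = begin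
    laplaceTerm M zero + sumFin (λ k → laplaceTerm M (suc k))  ≡⟨ cong (λ t → laplaceTerm M zero + t) (otherTerms n M below≡0) ⟩
    + 1 * M zero zero * det (minor M zero) + 0ℤ                ≡⟨ unit (M zero zero) (det (minor M zero)) ⟩
    M zero zero * det (minor M zero)                           ∎
    where
    unit : ∀ x d → + 1 * x * d + 0ℤ ≡ x * d
    unit = solve-∀
    otherTerms : ∀ n (M : Matrix (suc n)) → (∀ i → M (suc i) zero ≡ 0ℤ) → sumFin (λ k → laplaceTerm M (suc k)) ≡ 0ℤ
    otherTerms zero    M _       = refl
    otherTerms (suc n) M below≡0 = sumFin-zero λ k →
      trans (cong (sign (toℕ (suc k)) * M zero (suc k) *_) (det-zeroColumn₀ (minor M (suc k)) below≡0))
            (*-zeroʳ (sign (toℕ (suc k)) * M zero (suc k)))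

module SphereCount where

  open import Defs using (box; box1; norm1)
  open import Data.Nat using (ℕ; zero; suc; _+_; _∸_; _≤_; _<_; z≤n; s≤s)
  open import Data.Nat.Properties using (_≟_; ≤-trans; <⇒≱; m≤m+n; m∸n≤m; m+n∸m≡n; m+[n∸m]≡n)
  open import Data.Nat.ListAction using (sum)
  open import Data.Nat.ListAction.Properties using (sum-++)
  open import Data.Nat.Tactic.RingSolver using (solve-∀)
  open import Data.Integer as ℤ using (ℤ; ∣_∣)
  open import Data.List using (List; []; _∷_; _++_; map; concatMap; filter; length; upTo; applyUpTo)
  open import Data.List.Properties using (filter-++; length-++; filter-≐; filter-none; map-++; map-∘; map-upTo; map-cong)
  open import Data.List.Relation.Unary.All using (universal)
  open import Data.Vec using (Vec; _∷_)
  open import Data.Product using (_,_)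
  open import Data.Bool using (true; false)
  open import Relation.Nullary using (does)
  open import Relation.Unary using (Pred; Decidable)
  open import Function using (_∘_)
  open import Relation.Binary.PropositionalEquality
  open ≡-Reasoning

  -- Sorting the points by their first coordinate, which is either a ≥ 0 or -(a+1).
  sphereSize : ℕ → ℕ → ℕ
  sphereSize i (suc j) = sum (applyUpTo (λ a → sphereSize (i ∸ a) j) (suc i))
                       + sum (applyUpTo (λ a → sphereSize (i ∸ suc a) j) i)
  sphereSize zero    zero = 1
  sphereSize (suc i) zero = 0

  sphereSize-Delannoy : ∀ i j → sphereSize (suc i) (suc j) ≡ sphereSize (suc i) j + sphereSize i (suc j) + sphereSize i j
  sphereSize-Delannoy i j = regroup (sphereSize (suc i) j) (sphereSize i j) (sum (applyUpTo (λ a → sphereSize (i ∸ suc a) j) i))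
    where
    regroup : ∀ a c y → a + (c + y) + (c + y) ≡ a + ((c + y) + y) + c
    regroup = solve-∀

  sphereSize-radius₀ : ∀ j → sphereSize 0 j ≡ 1
  sphereSize-radius₀ zero    = refl
  sphereSize-radius₀ (suc j) = cong (λ s → s + 0 + 0) (sphereSize-radius₀ j)

  sphereSize-dimension₁ : ∀ i → sphereSize (suc i) 1 ≡ 2
  sphereSize-dimension₁ zero    = refl
  sphereSize-dimension₁ (suc i) = trans (sphereSize-Delannoy (suc i) 0) (cong (λ s → s + 0) (sphereSize-dimension₁ i))

  module _ {A : Set} {ℓ} {P : Pred A ℓ} (P? : Decidable P) where

    length-filter-concatMap : ∀ {B : Set} (g : B → List A) (xs : List B) →
      length (filter P? (concatMap g xs)) ≡ sum (map (λ x → length (filter P? (g x))) xs)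
    length-filter-concatMap g []       = refl
    length-filter-concatMap g (x ∷ xs) = begin
      length (filter P? (g x ++ concatMap g xs))                    ≡⟨ cong length (filter-++ P? (g x) (concatMap g xs)) ⟩
      length (filter P? (g x) ++ filter P? (concatMap g xs))       ≡⟨ length-++ (filter P? (g x)) ⟩
      length (filter P? (g x)) + length (filter P? (concatMap g xs)) ≡⟨ cong (length (filter P? (g x)) +_) (length-filter-concatMap g xs) ⟩
      length (filter P? (g x)) + sum (map (λ x → length (filter P? (g x))) xs) ∎

    length-filter-map : ∀ {B : Set} (g : B → A) (ys : List B) →
      length (filter P? (map g ys)) ≡ length (filter (P? ∘ g) ys)
    length-filter-map g []       = refl
    length-filter-map g (y ∷ ys) with does (P? (g y))
    ... | true  = cong suc (length-filter-map g ys)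
    ... | false = length-filter-map g ys

  sum-applyUpTo-truncate : ∀ {p n} (g h : ℕ → ℕ) → p ≤ n →
                           (∀ k → k < p → g k ≡ h k) → (∀ k → p ≤ k → g k ≡ 0) →
                           sum (applyUpTo g n) ≡ sum (applyUpTo h p)
  sum-applyUpTo-truncate {zero}  {zero}  g h _ _ _ = refl
  sum-applyUpTo-truncate {zero}  {suc n} g h _ _ vanish =
    cong₂ _+_ (vanish 0 z≤n) (sum-applyUpTo-truncate {n = n} (g ∘ suc) h z≤n (λ _ ()) (λ k _ → vanish (suc k) z≤n))
  sum-applyUpTo-truncate {suc p} {suc n} g h (s≤s p≤n) agree vanish =
    cong₂ _+_ (agree 0 (s≤s z≤n))
              (sum-applyUpTo-truncate (g ∘ suc) (h ∘ suc) p≤n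
                                      (λ k k<p → agree (suc k) (s≤s k<p)) (λ k p≤k → vanish (suc k) (s≤s p≤k)))

  sum-map-box1 : ∀ b (h : ℕ → ℕ) → sum (map (h ∘ ∣_∣) (box1 b)) ≡ sum (applyUpTo h (suc b)) + sum (applyUpTo (h ∘ suc) b)
  sum-map-box1 b h = begin
    sum (map (h ∘ ∣_∣) (box1 b)) ≡⟨ cong sum (map-++ (h ∘ ∣_∣) nonNegative negative) ⟩
    sum (map (h ∘ ∣_∣) nonNegative ++ map (h ∘ ∣_∣) negative) ≡⟨ sum-++ (map (h ∘ ∣_∣) nonNegative) _ ⟩
    sum (map (h ∘ ∣_∣) nonNegative) + sum (map (h ∘ ∣_∣) negative)
      ≡⟨ cong₂ (λ xs ys → sum xs + sum ys) (trans (sym (map-∘ (upTo (suc b)))) (map-upTo _ (suc b)))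
                                           (trans (sym (map-∘ (upTo b))) (map-upTo _ b)) ⟩
    sum (applyUpTo h (suc b)) + sum (applyUpTo (h ∘ suc) b) ∎
    where
    nonNegative negative : List ℤ
    nonNegative = map (λ k → ℤ.+ k) (upTo (suc b))
    negative    = map (λ k → ℤ.- (ℤ.+ suc k)) (upTo b)

  length-sphere∩box : ∀ b j i → i ≤ b → length (filter (λ x → norm1 x ≟ i) (box b j)) ≡ sphereSize i j
  length-sphere∩box b zero    zero    _   = refl
  length-sphere∩box b zero    (suc i) _   = refl
  length-sphere∩box b (suc j) i       i≤b = begin
    length (filter (λ x → norm1 x ≟ i) (concatMap (λ x → map (x ∷_) (box b j)) (box1 b)))
      ≡⟨ length-filter-concatMap (λ x → norm1 x ≟ i) (λ x → map (x ∷_) (box b j)) (box1 b) ⟩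
    sum (map (λ x → length (filter (λ x → norm1 x ≟ i) (map (x ∷_) (box b j)))) (box1 b))
      ≡⟨ cong sum (map-cong (λ x → length-filter-map (λ x → norm1 x ≟ i) (x ∷_) (box b j)) (box1 b)) ⟩
    sum (map (firstAbs ∘ ∣_∣) (box1 b))
      ≡⟨ sum-map-box1 b firstAbs ⟩
    sum (applyUpTo firstAbs (suc b)) + sum (applyUpTo (firstAbs ∘ suc) b)
      ≡⟨ cong₂ _+_ nonNegativeFirst negativeFirst ⟩
    sphereSize i (suc j) ∎
    where
    firstAbs : ℕ → ℕ
    firstAbs a = length (filter (λ v → a + norm1 v ≟ i) (box b j))
    firstAbs-≤ : ∀ a → a < suc i → firstAbs a ≡ sphereSize (i ∸ a) j
    firstAbs-≤ a (s≤s a≤i) =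
      trans (cong length (filter-≐ (λ v → a + norm1 v ≟ i) (λ v → norm1 v ≟ i ∸ a) ((λ {v} → shift {v}) , (λ {v} → unshift {v})) (box b j)))
            (length-sphere∩box b j (i ∸ a) (≤-trans (m∸n≤m i a) i≤b))
      where
      shift : ∀ {v : Vec ℤ j} → a + norm1 v ≡ i → norm1 v ≡ i ∸ a
      shift {v} eq = trans (sym (m+n∸m≡n a (norm1 v))) (cong (_∸ a) eq)
      unshift : ∀ {v : Vec ℤ j} → norm1 v ≡ i ∸ a → a + norm1 v ≡ i
      unshift eq = trans (cong (a +_) eq) (m+[n∸m]≡n a≤i)
    firstAbs-> : ∀ a → suc i ≤ a → firstAbs a ≡ 0
    firstAbs-> a i<a = cong length (filter-none _ (universal tooLarge (box b j)))
      where
      tooLarge : ∀ v → a + norm1 v ≢ i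
      tooLarge v eq = <⇒≱ i<a (subst (a ≤_) eq (m≤m+n a (norm1 v)))
    nonNegativeFirst : sum (applyUpTo firstAbs (suc b)) ≡ sum (applyUpTo (λ a → sphereSize (i ∸ a) j) (suc i))
    nonNegativeFirst = sum-applyUpTo-truncate firstAbs _ (s≤s i≤b) firstAbs-≤ firstAbs->
    negativeFirst : sum (applyUpTo (firstAbs ∘ suc) b) ≡ sum (applyUpTo (λ a → sphereSize (i ∸ suc a) j) i)
    negativeFirst = sum-applyUpTo-truncate (firstAbs ∘ suc) _ i≤b
                      (λ k k<i → firstAbs-≤ (suc k) (s≤s k<i)) (λ k i≤k → firstAbs-> (suc k) (s≤s i≤k))

module DelannoyArrays where

  open import Defs
  open Determinant
  open import Data.Nat as ℕ using (ℕ; zero; suc)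
  import Data.Nat.Properties as ℕ
  open import Data.Nat.Tactic.RingSolver as ℕ-Solver using ()
  open import Data.Nat.DivMod using (_/_; m*n/n≡m)
  open import Data.Integer using (ℤ; +_; _+_; _*_; _-_; 0ℤ)
  open import Data.Integer.Properties using (pos-*; pos-+)
  open import Data.Integer.Tactic.RingSolver using (solve-∀)
  open import Data.Fin using (zero; suc; toℕ)
  open import Data.Fin.Properties using (toℕ-inject₁)
  open import Relation.Binary.PropositionalEquality
  open ≡-Reasoning

  toMatrix : ∀ {n} → (ℕ → ℕ → ℤ) → Matrix n
  toMatrix M i j = M (toℕ i) (toℕ j)

  DelannoyRecurrence : (ℕ → ℕ → ℤ) → Set
  DelannoyRecurrence M = ∀ i j → M (suc i) (suc j) ≡ M (suc i) j + M i (suc j) + M i j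

  DelannoyRecurrence-pos : ∀ {N : ℕ → ℕ → ℕ} → (∀ i j → N (suc i) (suc j) ≡ N (suc i) j ℕ.+ N i (suc j) ℕ.+ N i j) →
                           DelannoyRecurrence (λ i j → + N i j)
  DelannoyRecurrence-pos {N} rec i j = begin
    + N (suc i) (suc j)                                  ≡⟨ cong +_ (rec i j) ⟩
    + (N (suc i) j ℕ.+ N i (suc j) ℕ.+ N i j)            ≡⟨ pos-+ (N (suc i) j ℕ.+ N i (suc j)) (N i j) ⟩
    + (N (suc i) j ℕ.+ N i (suc j)) + + N i j            ≡⟨ cong (_+ + N i j) (pos-+ (N (suc i) j) (N i (suc j))) ⟩
    + N (suc i) j + + N i (suc j) + + N i j              ∎

  adjacentRowSum : (ℕ → ℕ → ℤ) → ℕ → ℕ → ℤ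
  adjacentRowSum M i j = M (suc i) j + M i j

  adjacentRowSum-Delannoy : ∀ {M} → DelannoyRecurrence M → DelannoyRecurrence (adjacentRowSum M)
  adjacentRowSum-Delannoy {M} rec i j =
    trans (cong₂ _+_ (rec (suc i) j) (rec i j))
          (regroup (M (suc (suc i)) j) (M (suc i) (suc j)) (M (suc i) j) (M i (suc j)) (M i j))
    where
    regroup : ∀ a x b c d → a + x + b + (b + c + d) ≡ a + b + (x + c) + (b + d)
    regroup = solve-∀

  triangular : ℕ → ℕ
  triangular zero    = 0
  triangular (suc n) = triangular n ℕ.+ n

  triangular-double : ∀ n → triangular (suc n) ℕ.* 2 ≡ n ℕ.* suc n
  triangular-double zero    = refl
  triangular-double (suc n) = trans (ℕ.*-distribʳ-+ 2 (triangular (suc n)) (suc n))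
                                    (trans (cong (ℕ._+ suc n ℕ.* 2) (triangular-double n)) (regroup n))
    where
    regroup : ∀ n → n ℕ.* suc n ℕ.+ suc n ℕ.* 2 ≡ suc n ℕ.* suc (suc n)
    regroup = ℕ-Solver.solve-∀

  half-n*[1+n] : ∀ n → (n ℕ.* suc n) / 2 ≡ triangular (suc n)
  half-n*[1+n] n = trans (cong (_/ 2) (sym (triangular-double n))) (m*n/n≡m (triangular (suc n)) 2)

  det-Delannoy : ∀ n m (M : ℕ → ℕ → ℤ) → DelannoyRecurrence M → (∀ i → M i 0 ≡ + 2 ℕ.^ m) →
                 det {n} (toMatrix M) ≡ + 2 ℕ.^ (triangular n ℕ.+ m ℕ.* n)
  det-Delannoy zero    m M rec column₀ = cong (λ e → + 2 ℕ.^ e) (sym (ℕ.*-zeroʳ m))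
  det-Delannoy (suc n) m M rec column₀ = begin
    det {suc n} (toMatrix M)
      ≡⟨ det-subtractPrevious {n} (λ _ → + 1) (toMatrix M) ⟨
    det reduced
      ≡⟨ det-pivotColumn₀ reduced pivot ⟩
    M 0 0 * det (minor reduced zero)
      ≡⟨ cong₂ _*_ (column₀ 0) (det-cong minor≗) ⟩
    + 2 ℕ.^ m * det {n} (toMatrix (adjacentRowSum M))
      ≡⟨ cong (+ 2 ℕ.^ m *_) (det-Delannoy n (suc m) (adjacentRowSum M) (adjacentRowSum-Delannoy {M} rec) column₀′) ⟩
    + 2 ℕ.^ m * + 2 ℕ.^ (triangular n ℕ.+ suc m ℕ.* n)
      ≡⟨ pos-* (2 ℕ.^ m) _ ⟨
    + (2 ℕ.^ m ℕ.* 2 ℕ.^ (triangular n ℕ.+ suc m ℕ.* n))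
      ≡⟨ cong +_ (ℕ.^-distribˡ-+-* 2 m _) ⟨
    + 2 ℕ.^ (m ℕ.+ (triangular n ℕ.+ suc m ℕ.* n))
      ≡⟨ cong (λ e → + 2 ℕ.^ e) (exponent m n (triangular n)) ⟩
    + 2 ℕ.^ (triangular (suc n) ℕ.+ m ℕ.* suc n) ∎
    where
    reduced : Matrix (suc n)
    reduced = subtractPrevious (λ _ → + 1) (toMatrix M)
    cancel : ∀ x → x - + 1 * x ≡ 0ℤ
    cancel = solve-∀
    cancel′ : ∀ a c d → a + c + d - + 1 * c ≡ a + d
    cancel′ = solve-∀
    exponent : ∀ m n t → m ℕ.+ (t ℕ.+ suc m ℕ.* n) ≡ t ℕ.+ n ℕ.+ m ℕ.* suc n
    exponent = ℕ-Solver.solve-∀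
    pivot : ∀ i → reduced (suc i) zero ≡ 0ℤ
    pivot i rewrite toℕ-inject₁ i | column₀ (suc (toℕ i)) | column₀ (toℕ i) = cancel (+ 2 ℕ.^ m)
    minor≗ : ∀ i j → minor reduced zero i j ≡ adjacentRowSum M (toℕ i) (toℕ j)
    minor≗ i j rewrite toℕ-inject₁ i | rec (toℕ i) (toℕ j) =
      cancel′ (M (suc (toℕ i)) (toℕ j)) (M (toℕ i) (suc (toℕ j))) (M (toℕ i) (toℕ j))
    column₀′ : ∀ i → adjacentRowSum M i 0 ≡ + 2 ℕ.^ suc m
    column₀′ i rewrite column₀ (suc i) | column₀ i =
      trans (sym (pos-+ (2 ℕ.^ m) _)) (cong (λ x → + (2 ℕ.^ m ℕ.+ x)) (sym (ℕ.+-identityʳ (2 ℕ.^ m))))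

module SphereMatrices where

  open import Defs
  open Determinant
  open SphereCount
  open DelannoyArrays
  open import Data.Nat as ℕ using (ℕ; zero; suc)
  open import Data.Nat.Properties using (≤-refl)
  import Data.Nat.Properties as ℕ
  open import Data.Integer using (ℤ; +_; _+_; _*_; _-_; 0ℤ; -1ℤ)
  open import Data.Integer.Properties using (*-identityˡ)
  open import Data.Integer.Tactic.RingSolver using (solve-∀)
  open import Data.Fin using (Fin; zero; suc; toℕ)
  open import Data.Fin.Properties using (toℕ-inject₁)
  open import Relation.Binary.PropositionalEquality
  open ≡-Reasoning

  S≡sphereSize : ∀ i j → S i j ≡ sphereSize i j
  S≡sphereSize i j = length-sphere∩box i j i ≤-refl

  sphere₁₁ sphere₀₁ : ℕ → ℕ → ℤ
  sphere₁₁ i j = + sphereSize (suc i) (suc j)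
  sphere₀₁ i j = + sphereSize i (suc j)

  det-sphere₁₁ : ∀ n → det {n} (toMatrix sphere₁₁) ≡ + 2 ℕ.^ triangular (suc n)
  det-sphere₁₁ n = begin
    det {n} (toMatrix sphere₁₁)         ≡⟨ det-Delannoy n 1 sphere₁₁ rec column₀ ⟩
    + 2 ℕ.^ (triangular n ℕ.+ 1 ℕ.* n)  ≡⟨ cong (λ e → + 2 ℕ.^ (triangular n ℕ.+ e)) (ℕ.*-identityˡ n) ⟩
    + 2 ℕ.^ triangular (suc n)          ∎
    where
    rec : DelannoyRecurrence sphere₁₁
    rec = DelannoyRecurrence-pos {λ i j → sphereSize (suc i) (suc j)} (λ i j → sphereSize-Delannoy (suc i) (suc j))
    column₀ : ∀ i → sphere₁₁ i 0 ≡ + 2 ℕ.^ 1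
    column₀ i = cong +_ (sphereSize-dimension₁ i)

  det-S≡det-sphere₁₁ : ∀ n → det {suc n} (λ i j → + S (toℕ i) (toℕ j)) ≡ det {n} (toMatrix sphere₁₁)
  det-S≡det-sphere₁₁ n = begin
    det {suc n} (λ i j → + S (toℕ i) (toℕ j))      ≡⟨ det-cong {suc n} (λ i j → cong +_ (S≡sphereSize (toℕ i) (toℕ j))) ⟩
    det {suc n} (toMatrix (λ i j → + sphereSize i j)) ≡⟨ det-pivotColumn₀ {n} (toMatrix (λ i j → + sphereSize i j)) (λ i → refl) ⟩
    + 1 * det {n} (toMatrix sphere₁₁)               ≡⟨ *-identityˡ (det {n} (toMatrix sphere₁₁)) ⟩
    det {n} (toMatrix sphere₁₁)                     ∎

  det-C≡det-sphere₁₁ : ∀ n → det {suc n} (λ i j → + C (toℕ i) (toℕ j)) ≡ det {n} (toMatrix sphere₁₁)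
  det-C≡det-sphere₁₁ zero    = refl
  det-C≡det-sphere₁₁ (suc n) = begin
    det {suc (suc n)} (λ i j → + C (toℕ i) (toℕ j)) ≡⟨ det-cong {suc (suc n)} (λ i j → cong +_ (S≡sphereSize (toℕ i) (suc (toℕ j)))) ⟩
    det {suc (suc n)} (toMatrix sphere₀₁)            ≡⟨ det-subtractPrevious {suc n} twoThenOnes (toMatrix sphere₀₁) ⟨
    det reduced                                      ≡⟨ det-pivotColumn₀ reduced pivot ⟩
    + 1 * det (minor reduced zero)                   ≡⟨ *-identityˡ (det (minor reduced zero)) ⟩
    det (minor reduced zero)                         ≡⟨ det-cong minor≗ ⟩
    det (subtractPrevious {n} (λ _ → -1ℤ) (toMatrix sphere₁₁)) ≡⟨ det-subtractPrevious {n} (λ _ → -1ℤ) (toMatrix sphere₁₁) ⟩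
    det {suc n} (toMatrix sphere₁₁)                  ∎
    where
    -- The first column of sphere₀₁ is 1, 2, 2, 2, …
    twoThenOnes : ∀ {n} → Fin n → ℤ
    twoThenOnes zero    = + 2
    twoThenOnes (suc _) = + 1
    reduced : Matrix (suc (suc n))
    reduced = subtractPrevious twoThenOnes (toMatrix sphere₀₁)
    rec : DelannoyRecurrence sphere₀₁
    rec = DelannoyRecurrence-pos {λ i j → sphereSize i (suc j)} (λ i j → sphereSize-Delannoy i (suc j))
    row₀ : ∀ j → sphere₀₁ 0 j ≡ + 1
    row₀ j = cong +_ (sphereSize-radius₀ (suc j))
    pivot : ∀ i → reduced (suc i) zero ≡ 0ℤ
    pivot zero    = refl
    pivot (suc i) rewrite toℕ-inject₁ i =
      cong₂ (λ x y → + x - + 1 * + y) (sphereSize-dimension₁ (suc (toℕ i))) (sphereSize-dimension₁ (toℕ i))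
    cancel₁ : ∀ x → x + + 1 + + 1 - + 2 * + 1 ≡ x
    cancel₁ = solve-∀
    cancel₂ : ∀ a c d → a + c + d - + 1 * c ≡ a - -1ℤ * d
    cancel₂ = solve-∀
    minor≗ : ∀ i j → minor reduced zero i j ≡ subtractPrevious (λ _ → -1ℤ) (toMatrix sphere₁₁) i j
    minor≗ zero    j = begin
      sphere₀₁ 1 (suc (toℕ j)) - + 2 * sphere₀₁ 0 (suc (toℕ j))
        ≡⟨ cong₂ (λ x y → x - + 2 * y) (rec 0 (toℕ j)) (row₀ (suc (toℕ j))) ⟩
      sphere₀₁ 1 (toℕ j) + sphere₀₁ 0 (suc (toℕ j)) + sphere₀₁ 0 (toℕ j) - + 2 * + 1
        ≡⟨ cong₂ (λ c d → sphere₀₁ 1 (toℕ j) + c + d - + 2 * + 1) (row₀ (suc (toℕ j))) (row₀ (toℕ j)) ⟩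
      sphere₀₁ 1 (toℕ j) + + 1 + + 1 - + 2 * + 1
        ≡⟨ cancel₁ (sphere₀₁ 1 (toℕ j)) ⟩
      sphere₀₁ 1 (toℕ j) ∎
    minor≗ (suc i) j rewrite toℕ-inject₁ i = begin
      sphere₀₁ (suc r) (suc c) - + 1 * sphere₀₁ r (suc c)
        ≡⟨ cong (λ x → x - + 1 * sphere₀₁ r (suc c)) (rec r c) ⟩
      sphere₀₁ (suc r) c + sphere₀₁ r (suc c) + sphere₀₁ r c - + 1 * sphere₀₁ r (suc c)
        ≡⟨ cancel₂ (sphere₀₁ (suc r) c) (sphere₀₁ r (suc c)) (sphere₀₁ r c) ⟩
      sphere₀₁ (suc r) c - -1ℤ * sphere₀₁ r c ∎
      where
      r c : ℕ
      r = suc (toℕ i)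
      c = toℕ j

open DelannoyArrays using (toMatrix; half-n*[1+n])
open SphereMatrices
open import Defs
open import Data.Nat using (ℕ; suc; _^_; _*_)
open import Data.Nat.DivMod using (_/_)
open import Data.Integer using (+_)
open import Data.Fin using (toℕ)
open import Data.Product using (_×_)
open import Relation.Binary.PropositionalEquality using (_≡_)
open import Data.Product using (_,_)
open import Relation.Binary.PropositionalEquality using (cong; sym; trans)

mainTheorem20 : (n : ℕ) →
    (det {suc n} (λ i j → + S (toℕ i) (toℕ j)) ≡ + (2 ^ ((n * suc n) / 2)))
    × (det {suc n} (λ i j → + C (toℕ i) (toℕ j)) ≡ + (2 ^ ((n * suc n) / 2)))
mainTheorem20 n = trans (det-S≡det-sphere₁₁ n) core , trans (det-C≡det-sphere₁₁ n) core
  where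
  core : det {n} (toMatrix sphere₁₁) ≡ + (2 ^ ((n * suc n) / 2))
  core = trans (det-sphere₁₁ n) (cong (λ e → + (2 ^ e)) (sym (half-n*[1+n] n)))
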